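{- Let $A_<=(A,R^A,S^A),B_<=(B,R^B,S^B)\in\mathcal{F}_<$, let $a_1<\cdots<a_m$ be the enumeration of the branches of $A$ corresponding to $S^A$ and $b_1<\cdots<b_n$ the enumeration of the branches of $B$ corresponding to $S^B$. A function $f:B_<\to A_<$ is an epimorphism if and only if $f:(B,R^B)\to(A,R^A)$ is an epimorphism and there exist $1=k_1<k_2<\cdots<k_{m+1}=n+1$ such that for every $i=1,\ldots,n$ and $s=1,\ldots,m$, if $k_s\le i<k_{s+1}$ then $f(b_i)\subseteq a_s$.
   Context: A fan is a finite acyclic undirected connected simple graph with a distinguished root such that every non-root vertex has degree at most 2; $\preceq$ is the tree order; a branch is a maximal $\preceq$-chain. $\mathcal{F}_<$ is the class of finite structures $(A,R^A,S^A)$ where $A$ is a fan with all branches of the same height, $R^A(s,t)$ iff $s=t$ or $t$ is an immediate successor of $s$, and for some enumeration $a_1<\cdots<a_m$ of the branches (the enumeration corresponding to $S^A$), $S^A(x,y)$ iff $x\in a_i$, $y\in a_j$ for some $i\le j$. An epimorphism between finite structures in a relational language is a surjection $f$ such that for each relation symbol $Q$: $Q^A(x,y)$ iff $Q^B(x',y')$ for some $x',y'$ with $f(x')=x,f(y')=y$; for $f:(B,R^B)\to(A,R^A)$ only $R$ is considered, for $f:B_<\to A_<$ both $R$ and $S$. -}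

module Defs where

open import Data.Nat using (ℕ; zero; suc; _≤_; _<_)
open import Data.Fin using (Fin; toℕ; inject₁; fromℕ) renaming (zero to fzero; suc to fsuc; _≤_ to _≤ᶠ_)
open import Data.Maybe using (Maybe; just; nothing)
open import Data.Product using (Σ; ∃; _×_; _,_)
open import Data.Sum using (_⊎_)
open import Relation.Binary.PropositionalEquality using (_≡_)
open import Function.Bundles using (_⇔_)

-- A fan all of whose branches have the same height is determined (up to
-- isomorphism) by the number m ≥ 1 of branches and the number h of
-- non-root vertices on each branch.  If h = 0 the fan is the single root,
-- which has exactly one branch, so then m = 1.
-- Vertices: nothing = the root; just (i , j) = the vertex of depth j+1
-- on the i-th branch (branches indexed 0,...,m-1, listed in the order
-- a_1 < ... < a_m given by S).

record Fan< : Set where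
  field
    m   : ℕ
    h   : ℕ
    m≥1 : 1 ≤ m
    h0  : h ≡ 0 → m ≡ 1

open Fan< public

Pt : Fan< → Set
Pt A = Maybe (Fin (m A) × Fin (h A))

data R (A : Fan<) : Pt A → Pt A → Set where
  R-refl : ∀ {s} → R A s s
  R-root : ∀ {i} {j : Fin (h A)} → toℕ j ≡ 0 → R A nothing (just (i , j))
  R-step : ∀ {i} {j j′ : Fin (h A)} → toℕ j′ ≡ suc (toℕ j) →
           R A (just (i , j)) (just (i , j′))

InBranch : (A : Fan<) → Fin (m A) → Pt A → Set
InBranch A i x = (x ≡ nothing) ⊎ (Σ (Fin (h A)) λ j → x ≡ just (i , j))

S : (A : Fan<) → Pt A → Pt A → Set
S A x y = Σ (Fin (m A)) λ i → Σ (Fin (m A)) λ j →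
            (i ≤ᶠ j) × InBranch A i x × InBranch A j y

Surj : {X Y : Set} → (X → Y) → Set
Surj {X} {Y} f = (y : Y) → ∃ λ x → f x ≡ y

EpiRel : {X Y : Set} → (X → Y) → (X → X → Set) → (Y → Y → Set) → Set
EpiRel {X} {Y} f QB QA =
  (x y : Y) → QA x y ⇔ (∃ λ x′ → ∃ λ y′ → f x′ ≡ x × f y′ ≡ y × QB x′ y′)

IsEpiR : (B A : Fan<) → (Pt B → Pt A) → Set
IsEpiR B A f = Surj f × EpiRel f (R B) (R A)

IsEpiRS : (B A : Fan<) → (Pt B → Pt A) → Set
IsEpiRS B A f = Surj f × EpiRel f (R B) (R A) × EpiRel f (S B) (S A)

-- The block condition (0-based version of 1 = k_1 < ... < k_{m+1} = n+1
-- with f(b_i) ⊆ a_s whenever k_s ≤ i < k_{s+1}).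
BlockCond : (B A : Fan<) → (Pt B → Pt A) → Set
BlockCond B A f =
  Σ (Fin (suc (m A)) → ℕ) λ k →
    (k fzero ≡ 0) ×
    (k (fromℕ (m A)) ≡ m B) ×
    ((s : Fin (m A)) → k (inject₁ s) < k (fsuc s)) ×
    ((i : Fin (m B)) (s : Fin (m A)) →
       k (inject₁ s) ≤ toℕ i → toℕ i < k (fsuc s) →
       (x : Pt B) → InBranch B i x → InBranch A s (f x))

{-# OPTIONS --safe #-}
-- An S-homomorphism can only send a later branch of B into a later or equal branch of A,
-- so, apart from branches collapsed onto the root, the branches of B are mapped
-- monotonically onto those of A, and the s-th block starts at the first branch of B
-- reaching a branch of A of index at least s; surjectivity makes these starting points
-- strictly increasing.  Conversely, the blocks give a monotone map σ of branches with
-- f(b_i) ⊆ a_{σ i}, so f preserves S.  To lift S^A(x, y) when the chosen preimages of x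
-- and y come in the wrong order, monotonicity of σ puts x and y on one branch of A.  An
-- R-epimorphism fixes the root and climbs a branch of A at most one vertex per step, so
-- the branch of B through the preimage of the higher of x, y also passes through a
-- preimage of the lower one.
module Submission where

open import Defs
open import Data.Product using (_×_)
open import Function.Bundles using (_⇔_)

open import Data.Fin using (Fin; toℕ; inject₁; fromℕ; fromℕ<; zero; suc)
open import Data.Fin.Properties using (any?; toℕ<n; toℕ-inject₁; toℕ-fromℕ; toℕ-fromℕ<; toℕ-injective)
open import Data.Maybe using (just; nothing)
open import Data.Nat as ℕ using (ℕ; z≤n; s≤s; _≤?_; _<?_)
open import Data.Nat.Properties
open import Data.Product using (∃; ∃₂; _,_; proj₁; proj₂; map)
open import Data.Sum using (inj₁; inj₂)
open import Function using (_∘_; id)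
open import Function.Bundles using (mk⇔; Equivalence)
open import Relation.Binary.Core using (_⇒_)
open import Relation.Binary.Morphism.Definitions using (Homomorphic₂)
open import Relation.Binary.PropositionalEquality
open import Relation.Nullary using (yes; no; contradiction)
open import Relation.Unary using (Decidable)

-- n when no index satisfies P.
leastIndex : ∀ {n} {P : Fin n → Set} → Decidable P → ℕ
leastIndex {ℕ.zero} P? = 0
leastIndex {ℕ.suc n} P? with P? zero
... | yes _ = 0
... | no _ = ℕ.suc (leastIndex (P? ∘ suc))

leastIndex-≤ : ∀ {n} {P : Fin n → Set} (P? : Decidable P) → leastIndex P? ℕ.≤ n
leastIndex-≤ {ℕ.zero} P? = z≤n
leastIndex-≤ {ℕ.suc n} P? with P? zero
... | yes _ = z≤n
... | no _ = s≤s (leastIndex-≤ (P? ∘ suc))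

leastIndex-minimal : ∀ {n} {P : Fin n → Set} (P? : Decidable P) {i} → P i → leastIndex P? ℕ.≤ toℕ i
leastIndex-minimal {ℕ.suc n} P? {i} Pi with P? zero | i
... | yes _ | _ = z≤n
... | no ¬P0 | zero = contradiction Pi ¬P0
... | no _ | suc i = s≤s (leastIndex-minimal (P? ∘ suc) Pi)

leastIndex-witness : ∀ {n} {P : Fin n → Set} (P? : Decidable P) →
  leastIndex P? ℕ.< n → ∃ λ i → toℕ i ≡ leastIndex P? × P i
leastIndex-witness {ℕ.suc n} P? lt with P? zero
... | yes P0 = zero , refl , P0
... | no _ = map suc (map (cong ℕ.suc) id) (leastIndex-witness (P? ∘ suc) (≤-pred lt))

Increasing : ∀ {m} → (Fin (ℕ.suc m) → ℕ) → Set
Increasing k = ∀ s → k (inject₁ s) ℕ.< k (suc s)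

Increasing⇒monotone : ∀ {m} (k : Fin (ℕ.suc m) → ℕ) → Increasing k →
  ∀ a b → toℕ a ℕ.≤ toℕ b → k a ℕ.≤ k b
Increasing⇒monotone k inc zero zero _ = ≤-refl
Increasing⇒monotone {ℕ.suc m} k inc zero (suc b) _ =
  ≤-trans (<⇒≤ (inc zero)) (Increasing⇒monotone (k ∘ suc) (inc ∘ suc) zero b z≤n)
Increasing⇒monotone {ℕ.suc m} k inc (suc a) (suc b) (s≤s a≤b) =
  Increasing⇒monotone (k ∘ suc) (inc ∘ suc) a b a≤b

block-of : ∀ {m} (k : Fin (ℕ.suc m) → ℕ) x → k zero ℕ.≤ x → x ℕ.< k (fromℕ m) →
  ∃ λ s → k (inject₁ s) ℕ.≤ x × x ℕ.< k (suc s)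
block-of {ℕ.zero} k x k₀≤x x<k₀ = contradiction k₀≤x (<⇒≱ x<k₀)
block-of {ℕ.suc m} k x k₀≤x x<kₘ with x <? k (suc zero)
... | yes x<k₁ = zero , k₀≤x , x<k₁
... | no x≮k₁ = map suc id (block-of (k ∘ suc) x (≮⇒≥ x≮k₁) x<kₘ)

block-order : ∀ {m} (k : Fin (ℕ.suc m) → ℕ) → Increasing k → ∀ {s s′ x y} →
  k (inject₁ s) ℕ.≤ x → x ℕ.≤ y → y ℕ.< k (suc s′) → toℕ s ℕ.≤ toℕ s′
block-order k inc {s} {s′} kₛ≤x x≤y y<kₛ′ = ≮⇒≥ λ s′<s →
  <⇒≱ y<kₛ′ (≤-trans (Increasing⇒monotone k inc (suc s′) (inject₁ s)
                        (subst (ℕ.suc (toℕ s′) ℕ.≤_) (sym (toℕ-inject₁ s)) s′<s))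
                      (≤-trans kₛ≤x x≤y))

module _ {X Y : Set} (f : X → Y) where

  Image : (X → X → Set) → (Y → Y → Set)
  Image Q x y = ∃ λ x′ → ∃ λ y′ → f x′ ≡ x × f y′ ≡ y × Q x′ y′

  module _ {QB : X → X → Set} {QA : Y → Y → Set} where

    EpiRel⇒homomorphic : EpiRel f QB QA → Homomorphic₂ X Y QB QA f
    EpiRel⇒homomorphic epi {x} {y} q = Equivalence.from (epi (f x) (f y)) (x , y , refl , refl , q)

    homomorphic∧lifting⇒EpiRel : Homomorphic₂ X Y QB QA f → QA ⇒ Image QB → EpiRel f QB QA
    homomorphic∧lifting⇒EpiRel hom lift x y = mk⇔ lift λ { (_ , _ , refl , refl , q) → hom q }

module _ (A : Fan<) where

  point : Fin (m A) → Fin (ℕ.suc (h A)) → Pt A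
  point i zero = nothing
  point i (suc d) = just (i , d)

  point-InBranch : ∀ i d → InBranch A i (point i d)
  point-InBranch i zero = inj₁ refl
  point-InBranch i (suc d) = inj₂ (d , refl)

  point-R : ∀ i (d : Fin (h A)) → R A (point i (inject₁ d)) (point i (suc d))
  point-R i zero = R-root refl
  point-R i (suc d) = R-step (cong ℕ.suc (sym (toℕ-inject₁ d)))

  point-S : ∀ {i j} d d′ → toℕ i ℕ.≤ toℕ j → S A (point i d) (point j d′)
  point-S {i} {j} d d′ i≤j = i , j , i≤j , point-InBranch i d , point-InBranch j d′

  point-onto : ∀ x → ∃₂ λ i d → point i d ≡ x
  point-onto nothing = fromℕ< (m≥1 A) , zero , refl
  point-onto (just (i , d)) = i , suc d , refl

  -- The root lies on every branch; it gets index 0.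
  branchIndex : Pt A → ℕ
  branchIndex nothing = 0
  branchIndex (just (s , _)) = toℕ s

  branchIndex<m : ∀ x → branchIndex x ℕ.< m A
  branchIndex<m nothing = m≥1 A
  branchIndex<m (just (s , _)) = toℕ<n s

  InBranch-just⇒≡ : ∀ {t s e} → InBranch A t (just (s , e)) → s ≡ t
  InBranch-just⇒≡ (inj₂ (_ , refl)) = refl

  S⇒branchIndex-≤ : ∀ {y s e} → S A y (just (s , e)) → branchIndex y ℕ.≤ toℕ s
  S⇒branchIndex-≤ (_ , _ , _ , inj₁ refl , inj₂ (_ , refl)) = z≤n
  S⇒branchIndex-≤ (_ , _ , a≤b , inj₂ (_ , refl) , inj₂ (_ , refl)) = a≤b

  R-into-root : ∀ {y} → R A y nothing → y ≡ nothing
  R-into-root R-refl = refl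

  R-into-just : ∀ {y s e} {e′ : Fin (h A)} → R A y (just (s , e)) → toℕ e′ ℕ.< toℕ e →
    ∃ λ e₀ → y ≡ just (s , e₀) × toℕ e′ ℕ.≤ toℕ e₀
  R-into-just {e = e} R-refl e′<e = e , refl , <⇒≤ e′<e
  R-into-just (R-root e≡0) e′<e = contradiction (subst (_ ℕ.<_) e≡0 e′<e) n≮0
  R-into-just (R-step e≡1+e₀) e′<e = _ , refl , ≤-pred (subst (_ ℕ.<_) e≡1+e₀ e′<e)

  IsPath : ∀ {n} → (Fin (ℕ.suc n) → Pt A) → Set
  IsPath p = ∀ d → R A (p (inject₁ d)) (p (suc d))

  path-root⇒starts-at-root : ∀ {n} {p : Fin (ℕ.suc n) → Pt A} → IsPath p →
    ∀ d → p d ≡ nothing → p zero ≡ nothing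
  path-root⇒starts-at-root path zero pd = pd
  path-root⇒starts-at-root {ℕ.suc n} path (suc d) pd =
    path-root⇒starts-at-root (path ∘ inject₁) d (R-into-root (subst (R A _) pd (path d)))

  path-intermediate : ∀ {n} {p : Fin (ℕ.suc n) → Pt A} → IsPath p → p zero ≡ nothing →
    ∀ {s e} {e′ : Fin (h A)} d → p d ≡ just (s , e) → toℕ e′ ℕ.≤ toℕ e →
    ∃ λ d′ → p d′ ≡ just (s , e′)
  path-intermediate path p₀ zero pd _ = contradiction (trans (sym p₀) pd) λ ()
  path-intermediate {ℕ.suc n} path p₀ {s} (suc d) pd e′≤e with m≤n⇒m<n∨m≡n e′≤e
  ... | inj₂ e′≡e = suc d , trans pd (cong (λ e → just (s , e)) (sym (toℕ-injective e′≡e)))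
  ... | inj₁ e′<e =
    let _ , pd₀ , e′≤e₀ = R-into-just (subst (R A _) pd (path d)) e′<e
    in map inject₁ id (path-intermediate (path ∘ inject₁) p₀ d pd₀ e′≤e₀)

module _ {A B : Fan<} {f : Pt B → Pt A} where

  preimage-point : Surj f → ∀ y → ∃₂ λ i d → f (point B i d) ≡ y
  preimage-point onto y with onto y
  ... | x , fx≡y with point-onto B x
  ...   | i , d , refl = i , d , fx≡y

  module _ (R-hom : Homomorphic₂ (Pt B) (Pt A) (R B) (R A) f) where

    branch-path : ∀ i → IsPath A (f ∘ point B i)
    branch-path i = R-hom ∘ point-R B i

    root-fixed : Surj f → f nothing ≡ nothing
    root-fixed onto with preimage-point onto nothing
    ... | i , d , fx≡root = path-root⇒starts-at-root A (branch-path i) d fx≡root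

module BlockDecomposition {A B : Fan<} {f : Pt B → Pt A} (onto : Surj f)
  (R-hom : Homomorphic₂ (Pt B) (Pt A) (R B) (R A) f)
  (S-hom : Homomorphic₂ (Pt B) (Pt A) (S B) (S A) f) where

  branchIndex-monotone : ∀ {i j} d d′ {s e} → toℕ j ℕ.≤ toℕ i → f (point B i d) ≡ just (s , e) →
    branchIndex A (f (point B j d′)) ℕ.≤ toℕ s
  branchIndex-monotone d d′ j≤i fx =
    S⇒branchIndex-≤ A (subst (S A _) fx (S-hom (point-S B d′ d j≤i)))

  Reaches : ℕ → Fin (m B) → Set
  Reaches n i = ∃ λ d → n ℕ.≤ branchIndex A (f (point B i d))

  reaches? : ∀ n → Decidable (Reaches n)
  reaches? n i = any? λ d → n ≤? branchIndex A (f (point B i d))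

  K : ℕ → ℕ
  K n = leastIndex (reaches? n)

  <K-suc⇒index≤ : ∀ {n i d s e} → toℕ i ℕ.< K (ℕ.suc n) → f (point B i d) ≡ just (s , e) →
    toℕ s ℕ.≤ n
  <K-suc⇒index≤ {n} {d = d} i<K fx = ≮⇒≥ λ n<s → <⇒≱ i<K
    (leastIndex-minimal (reaches? (ℕ.suc n)) (d , subst (ℕ._<_ n ∘ branchIndex A) (sym fx) n<s))

  K≤⇒≤index : ∀ {n i d s e} → K n ℕ.≤ toℕ i → f (point B i d) ≡ just (s , e) → n ℕ.≤ toℕ s
  K≤⇒≤index {n} {i} K≤i fx =
    let j , j≡K , d′ , n≤j = leastIndex-witness (reaches? n) (≤-<-trans K≤i (toℕ<n i))
    in ≤-trans n≤j (branchIndex-monotone _ d′ (subst (ℕ._≤ toℕ i) (sym j≡K) K≤i) fx)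

  bounded⇒<K-suc : ∀ {n i} → (∀ j → toℕ j ℕ.≤ toℕ i → ∀ d → branchIndex A (f (point B j d)) ℕ.≤ n) →
    toℕ i ℕ.< K (ℕ.suc n)
  bounded⇒<K-suc {n} {i} bounded = ≰⇒> λ K≤i →
    let j , j≡K , d , n<j = leastIndex-witness (reaches? (ℕ.suc n)) (≤-<-trans K≤i (toℕ<n i))
    in <⇒≱ n<j (bounded j (subst (ℕ._≤ toℕ i) (sym j≡K) K≤i) d)

  branch-reached : ∀ s → ∃ λ i → Reaches (toℕ s) i ×
    (∀ j → toℕ j ℕ.≤ toℕ i → ∀ d → branchIndex A (f (point B j d)) ℕ.≤ toℕ s)
  branch-reached s with h A ℕ.≟ 0
  -- If h A = 0 there is no vertex (s , 0) to pull back, but then m A = 1.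
  ... | yes h≡0 = fromℕ< (m≥1 B) , (zero , subst (ℕ._≤ _) (sym (index≡0 (toℕ<n s))) z≤n) ,
                  λ j _ d → ≤-trans (≤-reflexive (index≡0 (branchIndex<m A (f (point B j d))))) z≤n
    where
    index≡0 : ∀ {n} → n ℕ.< m A → n ≡ 0
    index≡0 n<m = n<1⇒n≡0 (subst (_ ℕ.<_) (h0 A h≡0) n<m)
  ... | no h≢0 with preimage-point {A} {B} onto (just (s , fromℕ< (n≢0⇒n>0 h≢0)))
  ...   | i , d , fx =
    i , (d , ≤-reflexive (cong (branchIndex A) (sym fx))) , λ j j≤i d′ → branchIndex-monotone d d′ j≤i fx

  k : Fin (ℕ.suc (m A)) → ℕ
  k = K ∘ toℕ

  k-first : k zero ≡ 0
  k-first = n≤0⇒n≡0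
    (subst (K 0 ℕ.≤_) (toℕ-fromℕ< (m≥1 B)) (leastIndex-minimal (reaches? 0) (zero , z≤n)))

  k-last : k (fromℕ (m A)) ≡ m B
  k-last = trans (cong K (toℕ-fromℕ (m A))) (≤-antisym (leastIndex-≤ (reaches? (m A))) (≮⇒≥ λ K<m →
    let j , _ , d , m≤j = leastIndex-witness (reaches? (m A)) K<m
    in <⇒≱ (branchIndex<m A (f (point B j d))) m≤j))

  k-increasing : Increasing k
  k-increasing s =
    let i , reaches-s , bounded = branch-reached s
        Kₛ≤i = leastIndex-minimal (reaches? (toℕ s)) reaches-s
    in ≤-<-trans (subst (λ n → K n ℕ.≤ toℕ i) (sym (toℕ-inject₁ s)) Kₛ≤i) (bounded⇒<K-suc bounded)

  k-blocks : ∀ i s → k (inject₁ s) ℕ.≤ toℕ i → toℕ i ℕ.< k (suc s) →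
    ∀ x → InBranch B i x → InBranch A s (f x)
  k-blocks i s kₛ≤i i<kₛ₊₁ _ (inj₁ refl) = inj₁ (root-fixed R-hom onto)
  k-blocks i s kₛ≤i i<kₛ₊₁ _ (inj₂ (d , refl)) with f (just (i , d)) in fx
  ... | nothing = inj₁ refl
  ... | just (s′ , e) = inj₂ (e , cong (λ t → just (t , e)) (toℕ-injective (≤-antisym
          (<K-suc⇒index≤ i<kₛ₊₁ fx)
          (K≤⇒≤index (subst (λ n → K n ℕ.≤ toℕ i) (toℕ-inject₁ s) kₛ≤i) fx))))

  blockCond : BlockCond B A f
  blockCond = k , k-first , k-last , k-increasing , k-blocks

record BranchMap (B A : Fan<) (f : Pt B → Pt A) : Set where
  field
    σ : Fin (m B) → Fin (m A)
    σ-monotone : ∀ {i j} → toℕ i ℕ.≤ toℕ j → toℕ (σ i) ℕ.≤ toℕ (σ j)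
    σ-InBranch : ∀ i x → InBranch B i x → InBranch A (σ i) (f x)

BlockCond⇒BranchMap : ∀ {A B f} → BlockCond B A f → BranchMap B A f
BlockCond⇒BranchMap {B = B} (k , k-first , k-last , k-increasing , k-blocks) = record
  { σ = proj₁ ∘ block
  ; σ-monotone = λ {i} {j} i≤j →
      block-order k k-increasing (proj₁ (proj₂ (block i))) i≤j (proj₂ (proj₂ (block j)))
  ; σ-InBranch = λ i → let _ , kₛ≤i , i<kₛ₊₁ = block i in k-blocks i _ kₛ≤i i<kₛ₊₁
  }
  where
  block : ∀ (i : Fin (m B)) → ∃ λ s → k (inject₁ s) ℕ.≤ toℕ i × toℕ i ℕ.< k (suc s)
  block i = block-of k (toℕ i) (subst (ℕ._≤ toℕ i) (sym k-first) z≤n)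
                               (subst (toℕ i ℕ.<_) (sym k-last) (toℕ<n i))

module _ {A B : Fan<} {f : Pt B → Pt A} (onto : Surj f)
  (R-hom : Homomorphic₂ (Pt B) (Pt A) (R B) (R A) f) (branchMap : BranchMap B A f) where

  open BranchMap branchMap

  f-root : f nothing ≡ nothing
  f-root = root-fixed R-hom onto

  BranchMap⇒S-hom : Homomorphic₂ (Pt B) (Pt A) (S B) (S A) f
  BranchMap⇒S-hom (i , j , i≤j , x∈i , y∈j) =
    σ i , σ j , σ-monotone i≤j , σ-InBranch i _ x∈i , σ-InBranch j _ y∈j

  σ-point : ∀ {i d s e} → f (point B i d) ≡ just (s , e) → s ≡ σ i
  σ-point {i} {d} fx =
    InBranch-just⇒≡ A (subst (InBranch A (σ i)) fx (σ-InBranch i _ (point-InBranch B i d)))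

  lift-within-branch : ∀ {i j d d′ s s′ e e′} →
    f (point B i d) ≡ just (s , e) → f (point B j d′) ≡ just (s′ , e′) → s ≡ s′ →
    Image f (S B) (just (s , e)) (just (s′ , e′))
  lift-within-branch {i} {j} {d} {d′} {e = e} {e′ = e′} fx fy refl with ≤-total (toℕ e′) (toℕ e)
  ... | inj₁ e′≤e = let d″ , fy′ = path-intermediate A (branch-path R-hom i) f-root d fx e′≤e
                    in point B i d , point B i d″ , fx , fy′ , point-S B d d″ ≤-refl
  ... | inj₂ e≤e′ = let d″ , fx′ = path-intermediate A (branch-path R-hom j) f-root d′ fy e≤e′
                    in point B j d″ , point B j d′ , fx′ , fy , point-S B d″ d′ ≤-refl

  BranchMap⇒S-lifting : S A ⇒ Image f (S B)
  BranchMap⇒S-lifting {nothing} {y} _ =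
    let j , d′ , fy = preimage-point {A} {B} onto y
    in point B j zero , point B j d′ , f-root , fy , point-S B zero d′ ≤-refl
  BranchMap⇒S-lifting {just x} {nothing} _ =
    let i , d , fx = preimage-point {A} {B} onto (just x)
    in point B i d , point B i zero , fx , f-root , point-S B d zero ≤-refl
  BranchMap⇒S-lifting {just (s , e)} {just (s′ , e′)} xSy
    with preimage-point {A} {B} onto (just (s , e)) | preimage-point {A} {B} onto (just (s′ , e′))
  ... | i , d , fx | j , d′ , fy with toℕ i ≤? toℕ j
  ...   | yes i≤j = point B i d , point B j d′ , fx , fy , point-S B d d′ i≤j
  ...   | no i≰j =
    lift-within-branch fx fy (toℕ-injective (≤-antisym (S⇒branchIndex-≤ A xSy) s′≤s))
    where
    open ≤-Reasoning
    s′≤s : toℕ s′ ℕ.≤ toℕ s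
    s′≤s = begin
      toℕ s′    ≡⟨ cong toℕ (σ-point fy) ⟩
      toℕ (σ j) ≤⟨ σ-monotone (<⇒≤ (≰⇒> i≰j)) ⟩
      toℕ (σ i) ≡⟨ cong toℕ (sym (σ-point fx)) ⟩
      toℕ s     ∎

  BranchMap⇒S-epi : EpiRel f (S B) (S A)
  BranchMap⇒S-epi = homomorphic∧lifting⇒EpiRel f BranchMap⇒S-hom BranchMap⇒S-lifting

lemma7p1 : (A B : Fan<) (f : Pt B → Pt A) →
    IsEpiRS B A f ⇔ (IsEpiR B A f × BlockCond B A f)
lemma7p1 A B f = mk⇔
  (λ { (onto , R-epi , S-epi) →
         (onto , R-epi) , BlockDecomposition.blockCond onto (hom R-epi) (hom S-epi) })
  (λ { ((onto , R-epi) , blocks) →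
         onto , R-epi , BranchMap⇒S-epi onto (hom R-epi) (BlockCond⇒BranchMap blocks) })
  where
  hom : ∀ {QB QA} → EpiRel f QB QA → Homomorphic₂ (Pt B) (Pt A) QB QA f
  hom = EpiRel⇒homomorphic f
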